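{- Let $D$ be a connected locally finite C-homogeneous digraph and let $x\in VD$. Then neither the subdigraph induced by $N^+(x)$ nor the subdigraph induced by $N^-(x)$ is isomorphic to $C_4$.
   Context: A digraph has an irreflexive antisymmetric edge relation; connectedness refers to the underlying undirected graph. $D$ is C-homogeneous if every isomorphism between finite connected induced subdigraphs extends to an automorphism of $D$. $N^+(x)=\{y: xy\in ED\}$, $N^-(x)=\{y: yx\in ED\}$. $C_4$ is the directed cycle of length 4. -}

module Defs where

open import Level using (0ℓ)
open import Data.Fin using (Fin; zero; suc)
open import Data.Product using (Σ; _×_; _,_; ∃; proj₁)
open import Data.Sum using (_⊎_)
open import Data.Unit using (⊤)
open import Data.List using (List)
open import Data.List.Membership.Propositional using (_∈_)
open import Relation.Nullary using (¬_)
open import Relation.Unary using (Pred)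
open import Relation.Binary.PropositionalEquality using (_≡_)
open import Function.Bundles using (_⇔_; Bijection; _⤖_)
open import Function.Base using (_∘_)

record Digraph : Set₁ where
  field
    V      : Set
    E      : V → V → Set
    irrefl : ∀ x → ¬ E x x
    asym   : ∀ x y → E x y → ¬ E y x
open Digraph public

N⁺ : (D : Digraph) → V D → Pred (V D) 0ℓ
N⁺ D x y = E D x y

N⁻ : (D : Digraph) → V D → Pred (V D) 0ℓ
N⁻ D x y = E D y x

Adj : (D : Digraph) → V D → V D → Set
Adj D x y = E D x y ⊎ E D y x

data Walk (D : Digraph) (P : Pred (V D) 0ℓ) : V D → V D → Set where
  here : ∀ {x} → P x → Walk D P x x
  step : ∀ {x z y} → P x → Adj D x z → Walk D P z y → Walk D P x y

ConnectedOn : (D : Digraph) → Pred (V D) 0ℓ → Set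
ConnectedOn D P = ∀ x y → P x → P y → Walk D P x y

Connected : Digraph → Set
Connected D = ConnectedOn D (λ _ → ⊤)

FiniteSet : (D : Digraph) → Pred (V D) 0ℓ → Set
FiniteSet D P = Σ (List (V D)) λ xs → ∀ v → P v → v ∈ xs

LocallyFinite : Digraph → Set
LocallyFinite D = ∀ x → FiniteSet D (Adj D x)

IsIsoOn : (D₁ D₂ : Digraph) → Pred (V D₁) 0ℓ → Pred (V D₂) 0ℓ → (V D₁ → V D₂) → Set
IsIsoOn D₁ D₂ P Q f =
    (∀ x → P x → Q (f x))
  × (∀ x y → P x → P y → f x ≡ f y → x ≡ y)
  × (∀ y → Q y → Σ (V D₁) λ x → P x × f x ≡ y)
  × (∀ x y → P x → P y → (E D₁ x y ⇔ E D₂ (f x) (f y)))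

Automorphism : Digraph → Set
Automorphism D = Σ (V D ⤖ V D) λ g →
  ∀ x y → (E D x y ⇔ E D (Bijection.to g x) (Bijection.to g y))

CHomogeneous : Digraph → Set₁
CHomogeneous D =
  ∀ (P Q : Pred (V D) 0ℓ) (f : V D → V D) →
  FiniteSet D P → ConnectedOn D P →
  FiniteSet D Q → ConnectedOn D Q →
  IsIsoOn D D P Q f →
  Σ (Automorphism D) λ g → ∀ x → P x → Bijection.to (proj₁ g) x ≡ f x

data C4E : Fin 4 → Fin 4 → Set where
  e01 : C4E zero (suc zero)
  e12 : C4E (suc zero) (suc (suc zero))
  e23 : C4E (suc (suc zero)) (suc (suc (suc zero)))
  e30 : C4E (suc (suc (suc zero))) zero

C4 : Digraph
C4 = record { V = Fin 4 ; E = C4E ; irrefl = irr ; asym = as }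
  where
  irr : ∀ x → ¬ C4E x x
  irr _ ()
  as : ∀ x y → C4E x y → ¬ C4E y x
  as _ _ e01 ()
  as _ _ e12 ()
  as _ _ e23 ()
  as _ _ e30 ()

InducedIsoTo : (D : Digraph) → Pred (V D) 0ℓ → Digraph → Set
InducedIsoTo D P H = Σ (V H → V D) λ f → IsIsoOn H D (λ _ → ⊤) P f

-- Connectedness and local finiteness give decidable equality on vertices, which
-- is what is needed to extend a finite partial isomorphism by the identity; so
-- by C-homogeneity D is transitive on vertices, on arcs and on induced 2-arcs.
-- Suppose N⁺(x) induces a → b → c → d → a.  Reading off the cycle at the arc
-- x → a and moving it by arc-transitivity, every arc u → v has exactly one common
-- out-neighbour, exactly one w with u → w → v, and some common in-neighbour; a
-- pigeonhole argument on the finite set N⁻(v) shows that the latter is unique.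
-- Consequently every in-neighbourhood has four elements and contains no directed
-- triangle (a finite check on self-maps of Fin 4).  Now let y be the common
-- out-neighbour of a and b, and b → e → y: if a → e then e → y has two common
-- in-neighbours, if e → a then N⁻(y) contains a triangle, and otherwise moving
-- induced 2-arcs shows that all of N⁺(x) points to y, whereupon the induced
-- 2-arc x → a → y gives a contradiction.  The in-neighbourhood case follows by
-- reversing all arcs.
module Submission where

open import Defs
open import Level using (0ℓ)
open import Data.Nat using (ℕ; zero; suc; _+_)
open import Data.Nat.Properties using (+-suc; m≤n⇒∃[o]m+o≡n; n<1+n)
import Data.Nat.Properties as ℕ
open import Data.Fin using (Fin; zero; suc; toℕ)
import Data.Fin as Fin
open import Data.Fin.Properties using (pigeonhole; all?) renaming (_≟_ to _≟ᶠ_)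
import Data.Vec as Vec
open import Data.Vec.Properties using (lookup∘tabulate)
open import Data.Empty using (⊥; ⊥-elim)
open import Data.Product using (Σ; ∃; ∃₂; _×_; _,_; proj₁; proj₂)
open import Data.Sum using (inj₁; inj₂; swap)
open import Data.Unit using (⊤; tt)
open import Data.List using (List; []; _∷_; length; lookup; map; allFin)
import Data.List.Properties as List
open import Data.List.Membership.Propositional using (_∈_; lose)
open import Data.List.Membership.Propositional.Properties using (∈-map⁺; ∈-allFin)
open import Data.List.Relation.Unary.Any using (here; there; index; any?; satisfied)
open import Data.List.Relation.Unary.Any.Properties using (lookup-index)
open import Relation.Nullary using (¬_; Dec; yes; no)
open import Relation.Nullary.Decidable using (_→-dec_; ¬?; from-yes; ¬¬-excluded-middle)
open import Relation.Unary using (Pred)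
open import Relation.Binary.Definitions using (DecidableEquality)
open import Relation.Binary.PropositionalEquality
open import Function.Bundles using (_⇔_; mk⇔; Bijection; Equivalence)
import Function.Properties.Equivalence as ⇔

-- Pigeonhole principle for self-maps of a finite set: if ψ maps P injectively
-- into P and P is covered by a list, then ψ cannot miss a point s of P, since
-- the ψ-orbit of s would be an injective infinite sequence inside P.
injective-self-map-hits :
  {A : Set} (P : A → Set) (xs : List A) → (∀ a → P a → a ∈ xs) →
  (ψ : ∀ a → P a → A) → (∀ a p → P (ψ a p)) →
  (∀ a b p q → ψ a p ≡ ψ b q → a ≡ b) →
  ∀ s → P s → ¬ (∀ a p → ψ a p ≢ s)
injective-self-map-hits {A} P xs cover ψ ψ-in ψ-injective s ps missed =
  repeated (pigeonhole (n<1+n (length xs)) position)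
  where
    open ≡-Reasoning
    orbit : ℕ → Σ A P
    orbit zero    = s , ps
    orbit (suc n) = ψ (proj₁ (orbit n)) (proj₂ (orbit n)) , ψ-in _ _

    -- the orbit never revisits a point, because s is not in the image of ψ
    orbit-distinct : ∀ m k → proj₁ (orbit m) ≢ proj₁ (orbit (m + suc k))
    orbit-distinct zero    k e = missed _ _ (sym e)
    orbit-distinct (suc m) k e = orbit-distinct m k (ψ-injective _ _ _ _ e)

    position : Fin (suc (length xs)) → Fin (length xs)
    position n = index (cover _ (proj₂ (orbit (toℕ n))))

    at : ∀ n → proj₁ (orbit (toℕ n)) ≡ lookup xs (position n)
    at n = lookup-index (cover _ (proj₂ (orbit (toℕ n))))

    repeated : (∃₂ λ i j → i Fin.< j × position i ≡ position j) → ⊥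
    repeated (i , j , i<j , same) with k , i+k≡j ← m≤n⇒∃[o]m+o≡n i<j =
      orbit-distinct (toℕ i) k (begin
        proj₁ (orbit (toℕ i))         ≡⟨ at i ⟩
        lookup xs (position i)        ≡⟨ cong (lookup xs) same ⟩
        lookup xs (position j)        ≡⟨ at j ⟨
        proj₁ (orbit (toℕ j))         ≡⟨ cong (λ n → proj₁ (orbit n)) i+1+k≡j ⟨
        proj₁ (orbit (toℕ i + suc k)) ∎)
      where
      i+1+k≡j : toℕ i + suc k ≡ toℕ j
      i+1+k≡j = trans (+-suc (toℕ i) k) i+k≡j

-- A connected, locally finite digraph has decidable equality: fixing a base
-- vertex, every vertex is determined by a code (a list of neighbour positions
-- along a walk from the base), and codes are lists of naturals.
module WalkCodes (D : Digraph) (lf : LocallyFinite D) (conn : Connected D) (base : V D) where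

  entry : List (V D) → ℕ → V D → V D
  entry []       _       d = d
  entry (y ∷ ys) zero    d = y
  entry (y ∷ ys) (suc n) d = entry ys n d

  position : ∀ {y} {ys : List (V D)} → y ∈ ys → ℕ
  position (here _)  = zero
  position (there m) = suc (position m)

  entry-position : ∀ {y} {ys : List (V D)} (m : y ∈ ys) d → entry ys (position m) d ≡ y
  entry-position (here refl) d = refl
  entry-position (there m)   d = entry-position m d

  decode : V D → List ℕ → V D
  decode s []       = s
  decode s (n ∷ ns) = decode (entry (proj₁ (lf s)) n s) ns

  encode : ∀ {P s t} → Walk D P s t → List ℕ
  encode (here _)               = []
  encode (step {s} {z} _ adj w) = position (proj₂ (lf s) z adj) ∷ encode w

  decode-encode : ∀ {P s t} (w : Walk D P s t) → decode s (encode w) ≡ t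
  decode-encode (here _) = refl
  decode-encode (step {s} {z} _ adj w)
    rewrite entry-position (proj₂ (lf s) z adj) s = decode-encode w

  code : V D → List ℕ
  code t = encode (conn base t tt tt)

  decode-code : ∀ t → decode base (code t) ≡ t
  decode-code t = decode-encode (conn base t tt tt)

  _≟_ : DecidableEquality (V D)
  s ≟ t with List.≡-dec ℕ._≟_ (code s) (code t)
  ... | yes same = yes (trans (sym (decode-code s)) (trans (cong (decode base) same) (decode-code t)))
  ... | no  diff = no (λ s≡t → diff (cong code s≡t))

walk-append : ∀ {D P s t u} → Walk D P s t → Walk D P t u → Walk D P s u
walk-append (here _)       w′ = w′
walk-append (step p adj w) w′ = step p adj (walk-append w w′)

walk-start : ∀ {D P s t} → Walk D P s t → P s
walk-start (here p)       = p
walk-start (step p _ _)   = p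

walk-reverse : ∀ {D P s t} → Walk D P s t → Walk D P t s
walk-reverse (here p)       = here p
walk-reverse (step p adj w) = walk-append (walk-reverse w) (step (walk-start w) (swap adj) (here p))

connected-from-root : (D : Digraph) (r : V D) → (∀ v → Walk D (λ _ → ⊤) r v) → Connected D
connected-from-root D r reach s t _ _ = walk-append (walk-reverse (reach s)) (reach t)

Fin-listed : ∀ n → Σ (List (Fin n)) λ xs → ∀ i → ⊤ → i ∈ xs
Fin-listed n = allFin n , λ i _ → ∈-allFin i

Point : Digraph
Point = record { V = Fin 1 ; E = λ _ _ → ⊥ ; irrefl = λ _ () ; asym = λ _ _ () }

data ArcE : Fin 2 → Fin 2 → Set where
  arc : ArcE zero (suc zero)

Arc : Digraph
Arc = record { V = Fin 2 ; E = ArcE ; irrefl = λ { _ () } ; asym = λ { _ _ arc () } }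

data TwoArcE : Fin 3 → Fin 3 → Set where
  first  : TwoArcE zero (suc zero)
  second : TwoArcE (suc zero) (suc (suc zero))

TwoArc : Digraph
TwoArc = record { V = Fin 3 ; E = TwoArcE ; irrefl = λ { _ () } ; asym = asym′ }
  where
  asym′ : ∀ i j → TwoArcE i j → ¬ TwoArcE j i
  asym′ _ _ first  ()
  asym′ _ _ second ()

Point-connected : Connected Point
Point-connected = connected-from-root Point zero λ { zero → here tt }

Arc-connected : Connected Arc
Arc-connected = connected-from-root Arc zero λ
  { zero → here tt ; (suc zero) → step tt (inj₁ arc) (here tt) }

TwoArc-connected : Connected TwoArc
TwoArc-connected = connected-from-root TwoArc zero λ
  { zero             → here tt
  ; (suc zero)       → step tt (inj₁ first) (here tt)
  ; (suc (suc zero)) → step tt (inj₁ first) (step tt (inj₁ second) (here tt)) }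

CommonOut CommonIn Between : (D : Digraph) → V D → V D → V D → Set
CommonOut D u v w = E D u w × E D v w
CommonIn  D u v w = E D w u × E D w v
Between   D u v w = E D u w × E D w v

Enumerates : {A : Set} {n : ℕ} → (A → Set) → (Fin n → A) → Set
Enumerates S β =
  (∀ i → S (β i)) × (∀ i j → β i ≡ β j → i ≡ j) × (∀ t → S t → ∃ λ i → β i ≡ t)

AtMostOne : {A : Set} → (A → A → A → Set) → A → A → Set
AtMostOne Φ u v = ∀ {w w′} → Φ u v w → Φ u v w′ → w ≡ w′

arc-distinct : (D : Digraph) {u v : V D} → E D u v → u ≢ v
arc-distinct D {u} uv refl = irrefl D u uv

both-false : {A B : Set} → ¬ A → ¬ B → A ⇔ B
both-false ¬a ¬b = mk⇔ (λ a → ⊥-elim (¬a a)) (λ b → ⊥-elim (¬b b))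

both-true : {A B : Set} → A → B → A ⇔ B
both-true a b = mk⇔ (λ _ → b) (λ _ → a)

module Automorphisms (D : Digraph) where

  module Aut (g : Automorphism D) where
    apply : V D → V D
    apply = Bijection.to (proj₁ g)

    unapply : V D → V D
    unapply t = proj₁ (Bijection.surjective (proj₁ g) t)

    apply-unapply : ∀ t → apply (unapply t) ≡ t
    apply-unapply t = proj₂ (Bijection.surjective (proj₁ g) t) refl

    injective : ∀ {u v} → apply u ≡ apply v → u ≡ v
    injective = Bijection.injective (proj₁ g)

    preserves : ∀ {u v} → E D u v → E D (apply u) (apply v)
    preserves {u} {v} = Equivalence.to (proj₂ g u v)

    reflects : ∀ {u v} → E D (apply u) (apply v) → E D u v
    reflects {u} {v} = Equivalence.from (proj₂ g u v)

    carries : ∀ {u v u′ v′} → apply u ≡ u′ → apply v ≡ v′ → E D u v → E D u′ v′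
    carries refl refl = preserves

  open Aut public using (apply)

  enumeration-image : ∀ (g : Automorphism D) {n u} {h : Fin n → V D} → Enumerates (N⁺ D u) h →
                      Enumerates (N⁺ D (apply g u)) (λ i → apply g (h i))
  enumeration-image g {u = u} (h-in , h-injective , h-onto) =
      (λ i → Aut.preserves g (h-in i))
    , (λ i j same → h-injective i j (Aut.injective g same))
    , λ t gu→t → let i , hi≡t′ = h-onto (Aut.unapply g t) (preimage gu→t)
                 in i , trans (cong (apply g) hi≡t′) (Aut.apply-unapply g t)
    where
    preimage : ∀ {t} → E D (apply g u) t → E D u (Aut.unapply g t)
    preimage {t} gu→t = Aut.reflects g (subst (E D (apply g u)) (sym (Aut.apply-unapply g t)) gu→t)

Embedding : (D H : Digraph) → (V H → V D) → Set
Embedding D H p = (∀ i j → p i ≡ p j → i ≡ j) × (∀ i j → E H i j ⇔ E D (p i) (p j))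

point-embedding : ∀ D u → Embedding D Point (λ _ → u)
point-embedding D u = (λ { zero zero _ → refl }) , λ { zero zero → both-false (λ ()) (irrefl D u) }

arc-embedding : ∀ D {u v} → E D u v → Embedding D Arc λ { zero → u ; (suc zero) → v }
arc-embedding D {u} {v} uv = injective , arcs
  where
  injective : ∀ i j → _ → i ≡ j
  injective zero       zero       _ = refl
  injective zero       (suc zero) e = ⊥-elim (arc-distinct D uv e)
  injective (suc zero) zero       e = ⊥-elim (arc-distinct D uv (sym e))
  injective (suc zero) (suc zero) _ = refl
  arcs : ∀ i j → ArcE i j ⇔ _
  arcs zero       zero       = both-false (λ ()) (irrefl D u)
  arcs zero       (suc zero) = both-true arc uv
  arcs (suc zero) zero       = both-false (λ ()) (asym D u v uv)
  arcs (suc zero) (suc zero) = both-false (λ ()) (irrefl D v)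

InducedTwoArc : (D : Digraph) → V D → V D → V D → Set
InducedTwoArc D u v w = E D u v × E D v w × ¬ E D u w × ¬ E D w u

two-arc-embedding : ∀ D {u v w} → InducedTwoArc D u v w →
                    Embedding D TwoArc λ { zero → u ; (suc zero) → v ; (suc (suc zero)) → w }
two-arc-embedding D {u} {v} {w} (uv , vw , ¬uw , ¬wu) = injective , arcs
  where
  u≢w : u ≢ w
  u≢w refl = asym D u v uv vw
  injective : ∀ i j → _ → i ≡ j
  injective zero             zero             _ = refl
  injective zero             (suc zero)       e = ⊥-elim (arc-distinct D uv e)
  injective zero             (suc (suc zero)) e = ⊥-elim (u≢w e)
  injective (suc zero)       zero             e = ⊥-elim (arc-distinct D uv (sym e))
  injective (suc zero)       (suc zero)       _ = refl
  injective (suc zero)       (suc (suc zero)) e = ⊥-elim (arc-distinct D vw e)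
  injective (suc (suc zero)) zero             e = ⊥-elim (u≢w (sym e))
  injective (suc (suc zero)) (suc zero)       e = ⊥-elim (arc-distinct D vw (sym e))
  injective (suc (suc zero)) (suc (suc zero)) _ = refl
  arcs : ∀ i j → TwoArcE i j ⇔ _
  arcs zero             zero             = both-false (λ ()) (irrefl D u)
  arcs zero             (suc zero)       = both-true first uv
  arcs zero             (suc (suc zero)) = both-false (λ ()) ¬uw
  arcs (suc zero)       zero             = both-false (λ ()) (asym D u v uv)
  arcs (suc zero)       (suc zero)       = both-false (λ ()) (irrefl D v)
  arcs (suc zero)       (suc (suc zero)) = both-true second vw
  arcs (suc (suc zero)) zero             = both-false (λ ()) ¬wu
  arcs (suc (suc zero)) (suc zero)       = both-false (λ ()) (asym D v w vw)
  arcs (suc (suc zero)) (suc (suc zero)) = both-false (λ ()) (irrefl D w)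

module Homogeneity (D : Digraph) (_≟_ : DecidableEquality (V D)) (hom : CHomogeneous D) where

  open Automorphisms D public

  Image : {I : Set} → (I → V D) → Pred (V D) 0ℓ
  Image p t = ∃ λ i → p i ≡ t

  -- Any two embeddings of a finite connected digraph H differ by an automorphism:
  -- the isomorphism p i ↦ q i between the images is extended by C-homogeneity.
  extend : (H : Digraph) → FiniteSet H (λ _ → ⊤) → Connected H →
           ∀ {p q} → Embedding D H p → Embedding D H q →
           Σ (Automorphism D) λ g → ∀ i → apply g (p i) ≡ q i
  extend H (xs , listed) H-connected {p} {q} (p-inj , p-arcs) (q-inj , q-arcs) =
    restrict (hom (Image p) (Image q) φ (finite p) (connected p p-arcs)
                  (finite q) (connected q q-arcs) isomorphism)
    where
    φ : V D → V D
    φ t with any? (λ i → p i ≟ t) xs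
    ... | yes found = q (proj₁ (satisfied found))
    ... | no  _     = t

    φ-image : ∀ i → φ (p i) ≡ q i
    φ-image i with any? (λ j → p j ≟ p i) xs
    ... | yes found = cong q (p-inj _ _ (proj₂ (satisfied found)))
    ... | no  none  = ⊥-elim (none (lose (listed i tt) refl))

    finite : (r : V H → V D) → FiniteSet D (Image r)
    finite r = map r xs , λ { _ (i , refl) → ∈-map⁺ r (listed i tt) }

    connected : (r : V H → V D) → (∀ i j → E H i j ⇔ E D (r i) (r j)) → ConnectedOn D (Image r)
    connected r r-arcs _ _ (i , refl) (j , refl) = image-walk (H-connected i j tt tt)
      where
      image-walk : ∀ {i j} → Walk H (λ _ → ⊤) i j → Walk D (Image r) (r i) (r j)
      image-walk (here _) = here (_ , refl)
      image-walk (step {s} {z} _ (inj₁ sz) w) =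
        step (s , refl) (inj₁ (Equivalence.to (r-arcs s z) sz)) (image-walk w)
      image-walk (step {s} {z} _ (inj₂ zs) w) =
        step (s , refl) (inj₂ (Equivalence.to (r-arcs z s) zs)) (image-walk w)

    isomorphism : IsIsoOn D D (Image p) (Image q) φ
    isomorphism =
        (λ { _ (i , refl) → i , sym (φ-image i) })
      , (λ { _ _ (i , refl) (j , refl) same →
               cong p (q-inj i j (trans (sym (φ-image i)) (trans same (φ-image j)))) })
      , (λ { _ (i , refl) → p i , (i , refl) , φ-image i })
      , (λ { _ _ (i , refl) (j , refl) →
               subst₂ (λ s t → E D (p i) (p j) ⇔ E D s t) (sym (φ-image i)) (sym (φ-image j))
                      (⇔.trans (⇔.sym (p-arcs i j)) (q-arcs i j)) })

    restrict : (Σ (Automorphism D) λ g → ∀ t → Image p t → apply g t ≡ φ t) →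
               Σ (Automorphism D) λ g → ∀ i → apply g (p i) ≡ q i
    restrict (g , agrees) = g , λ i → trans (agrees (p i) (i , refl)) (φ-image i)

  vertex-transitive : ∀ u u′ → Σ (Automorphism D) λ g → apply g u ≡ u′
  vertex-transitive u u′
    with g , agrees ← extend Point (Fin-listed 1) Point-connected (point-embedding D u) (point-embedding D u′)
    = g , agrees zero

  arc-transitive : ∀ {u v u′ v′} → E D u v → E D u′ v′ →
                   Σ (Automorphism D) λ g → apply g u ≡ u′ × apply g v ≡ v′
  arc-transitive uv u′v′
    with g , agrees ← extend Arc (Fin-listed 2) Arc-connected (arc-embedding D uv) (arc-embedding D u′v′)
    = g , agrees zero , agrees (suc zero)

  two-arc-transitive : ∀ {u v w u′ v′ w′} → InducedTwoArc D u v w → InducedTwoArc D u′ v′ w′ →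
    Σ (Automorphism D) λ g → apply g u ≡ u′ × apply g v ≡ v′ × apply g w ≡ w′
  two-arc-transitive path path′
    with g , agrees ← extend TwoArc (Fin-listed 3) TwoArc-connected
                             (two-arc-embedding D path) (two-arc-embedding D path′)
    = g , agrees zero , agrees (suc zero) , agrees (suc (suc zero))

  Preserved : (V D → V D → V D → Set) → Set
  Preserved Φ = ∀ (g : Automorphism D) {u v w} → Φ u v w → Φ (apply g u) (apply g v) (apply g w)

  CommonOut-preserved : Preserved (CommonOut D)
  CommonOut-preserved g (uw , vw) = Aut.preserves g uw , Aut.preserves g vw

  CommonIn-preserved : Preserved (CommonIn D)
  CommonIn-preserved g (wu , wv) = Aut.preserves g wu , Aut.preserves g wv

  Between-preserved : Preserved (Between D)
  Between-preserved g (uw , wv) = Aut.preserves g uw , Aut.preserves g wv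

  witness-on-every-arc : ∀ {Φ u v} → Preserved Φ → E D u v → ∃ (Φ u v) →
                         ∀ {u′ v′} → E D u′ v′ → ∃ (Φ u′ v′)
  witness-on-every-arc {Φ} Φ-pres uv (w , φ) u′v′ with g , gu , gv ← arc-transitive uv u′v′
    = apply g w , subst₂ (λ s t → Φ s t (apply g w)) gu gv (Φ-pres g φ)

  at-most-one-on-every-arc : ∀ {Φ u v} → Preserved Φ → E D u v → AtMostOne Φ u v →
                             ∀ {u′ v′} → E D u′ v′ → AtMostOne Φ u′ v′
  at-most-one-on-every-arc {Φ} Φ-pres uv unique u′v′ φ φ′
    with g , gu′ , gv′ ← arc-transitive u′v′ uv
    = Aut.injective g (unique (moved φ) (moved φ′))
    where
    moved : ∀ {w} → Φ _ _ w → Φ _ _ (apply g w)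
    moved φ = subst₂ (λ s t → Φ s t _) gu′ gv′ (Φ-pres g φ)

NoThreeCycle : (Fin 4 → Fin 4) → Set
NoThreeCycle τ =
  (∀ i j → τ i ≡ τ j → i ≡ j) → (∀ i → τ i ≢ i) → ∀ i → τ (τ (τ i)) ≢ i

NoThreeCycle-pointwise : ∀ {σ τ} → (∀ i → σ i ≡ τ i) → NoThreeCycle σ → NoThreeCycle τ
NoThreeCycle-pointwise {σ} {τ} σ≗τ σ-ok τ-injective τ-fixed-free i τ³i≡i =
  σ-ok (λ i j e → τ-injective i j (trans (sym (σ≗τ i)) (trans e (σ≗τ j))))
       (λ i e → τ-fixed-free i (trans (sym (σ≗τ i)) e))
       i (trans σ³≡τ³ τ³i≡i)
  where
  σ³≡τ³ : σ (σ (σ i)) ≡ τ (τ (τ i))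
  σ³≡τ³ = trans (σ≗τ _) (cong τ (trans (σ≗τ _) (cong τ (σ≗τ i))))

-- A finite check: the claim is decided for each of the 4⁴ value tables
-- (τ 0, τ 1, τ 2, τ 3), and τ agrees pointwise with the lookup in its own table.
no-three-cycle-Fin4 : ∀ τ → NoThreeCycle τ
no-three-cycle-Fin4 τ =
  NoThreeCycle-pointwise (lookup∘tabulate τ)
    (every-table (τ zero) (τ (suc zero)) (τ (suc (suc zero))) (τ (suc (suc (suc zero)))))
  where
  decide : ∀ v → Dec (NoThreeCycle (Vec.lookup v))
  decide v = (all? λ i → all? λ j → (Vec.lookup v i ≟ᶠ Vec.lookup v j) →-dec (i ≟ᶠ j))
    →-dec ((all? λ i → ¬? (Vec.lookup v i ≟ᶠ i))
    →-dec (all? λ i → ¬? (Vec.lookup v (Vec.lookup v (Vec.lookup v i)) ≟ᶠ i)))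

  every-table : ∀ a b c d → NoThreeCycle (Vec.lookup (a Vec.∷ b Vec.∷ c Vec.∷ d Vec.∷ Vec.[]))
  every-table = from-yes (all? {4} λ a → all? {4} λ b → all? {4} λ c → all? {4} λ d →
                            decide (a Vec.∷ b Vec.∷ c Vec.∷ d Vec.∷ Vec.[]))

no-three-cycle : {A : Set} (S : A → Set) (β : Fin 4 → A) → Enumerates S β →
  (R : A → A → Set) →
  (∀ t → S t → ∃ λ t′ → S t′ × R t t′) →
  (∀ {t t₁ t₂} → S t → S t₁ → S t₂ → R t t₁ → R t t₂ → t₁ ≡ t₂) →
  (∀ {t₁ t₂ t} → S t₁ → S t₂ → S t → R t₁ t → R t₂ t → t₁ ≡ t₂) →
  (∀ t → ¬ R t t) →
  ∀ {p q r} → S p → S q → S r → R p q → R q r → R r p → ⊥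
no-three-cycle S β (β-in , β-injective , β-onto) R successor successor-unique predecessor-unique
               irreflexive Sp Sq Sr pq qr rp =
  no-three-cycle-Fin4 τ τ-injective τ-fixed-point-free (index-of Sp)
    (trans (cong τ (trans (cong τ (τ-step Sp Sq pq)) (τ-step Sq Sr qr))) (τ-step Sr Sp rp))
  where
  index-of : ∀ {t} → S t → Fin 4
  index-of {t} St = proj₁ (β-onto t St)

  next : Fin 4 → _
  next i = proj₁ (successor (β i) (β-in i))

  S-next : ∀ i → S (next i)
  S-next i = proj₁ (proj₂ (successor (β i) (β-in i)))

  R-next : ∀ i → R (β i) (next i)
  R-next i = proj₂ (proj₂ (successor (β i) (β-in i)))

  τ : Fin 4 → Fin 4
  τ i = index-of (S-next i)

  β-τ : ∀ i → β (τ i) ≡ next i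
  β-τ i = proj₂ (β-onto _ (S-next i))

  τ-injective : ∀ i j → τ i ≡ τ j → i ≡ j
  τ-injective i j same = β-injective i j
    (predecessor-unique (β-in i) (β-in j) (S-next i) (R-next i)
       (subst (R (β j)) (trans (sym (β-τ j)) (trans (cong β (sym same)) (β-τ i))) (R-next j)))

  τ-fixed-point-free : ∀ i → τ i ≢ i
  τ-fixed-point-free i same =
    irreflexive (β i) (subst (R (β i)) (trans (sym (β-τ i)) (cong β same)) (R-next i))

  τ-step : ∀ {t t′} (St : S t) (St′ : S t′) → R t t′ → τ (index-of St) ≡ index-of St′
  τ-step {t} {t′} St St′ tt′ = β-injective _ _ (begin
    β (τ (index-of St))  ≡⟨ β-τ (index-of St) ⟩
    next (index-of St)   ≡⟨ successor-unique (β-in _) (S-next _) St′ (R-next _) R-β-t′ ⟩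
    t′                   ≡⟨ proj₂ (β-onto t′ St′) ⟨
    β (index-of St′)     ∎)
    where
    open ≡-Reasoning
    R-β-t′ : R (β (index-of St)) t′
    R-β-t′ = subst (λ s → R s t′) (sym (proj₂ (β-onto t St))) tt′

module OutNeighbourhoodC4 (D : Digraph) (_≟_ : DecidableEquality (V D)) (lf : LocallyFinite D)
  (hom : CHomogeneous D) (x : V D) (f : Fin 4 → V D)
  (iso : IsIsoOn C4 D (λ _ → ⊤) (N⁺ D x) f) where

  open Homogeneity D _≟_ hom
  open Aut using (carries)

  out-x : Enumerates (N⁺ D x) f
  out-x = (λ i → proj₁ iso i tt)
        , (λ i j → proj₁ (proj₂ iso) i j tt tt)
        , λ t xt → let i , _ , fi≡t = proj₁ (proj₂ (proj₂ iso)) t xt in i , fi≡t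

  x→ : ∀ i → E D x (f i)
  x→ = proj₁ out-x

  f-arcs : ∀ i j → C4E i j ⇔ E D (f i) (f j)
  f-arcs i j = proj₂ (proj₂ (proj₂ iso)) i j tt tt

  a b c d : V D
  a = f zero
  b = f (suc zero)
  c = f (suc (suc zero))
  d = f (suc (suc (suc zero)))

  C4-arc : ∀ {i j} → C4E i j → E D (f i) (f j)
  C4-arc {i} {j} = Equivalence.to (f-arcs i j)

  C4-non-arc : ∀ {i j} → ¬ C4E i j → ¬ E D (f i) (f j)
  C4-non-arc {i} {j} ¬ij fij = ¬ij (Equivalence.from (f-arcs i j) fij)

  a→b : E D a b
  a→b = C4-arc e01

  a-b-c : InducedTwoArc D a b c
  a-b-c = a→b , C4-arc e12 , C4-non-arc (λ ()) , C4-non-arc (λ ())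

  d-a-b : InducedTwoArc D d a b
  d-a-b = C4-arc e30 , a→b , C4-non-arc (λ ()) , C4-non-arc (λ ())

  only-out-of-a : ∀ {w} → CommonOut D x a w → w ≡ b
  only-out-of-a (xw , aw) with i , refl ← proj₂ (proj₂ out-x) _ xw =
    cong f (C4-successor (Equivalence.from (f-arcs zero i) aw))
    where
    C4-successor : ∀ {i} → C4E zero i → i ≡ suc zero
    C4-successor e01 = refl

  only-into-a : ∀ {w} → Between D x a w → w ≡ d
  only-into-a (xw , wa) with i , refl ← proj₂ (proj₂ out-x) _ xw =
    cong f (C4-predecessor (Equivalence.from (f-arcs i zero) wa))
    where
    C4-predecessor : ∀ {i} → C4E i zero → i ≡ suc (suc (suc zero))
    C4-predecessor e30 = refl

  common-out : ∀ {u v} → E D u v → ∃ (CommonOut D u v)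
  common-out = witness-on-every-arc CommonOut-preserved (x→ zero) (b , x→ (suc zero) , a→b)

  common-out-unique : ∀ {u v} → E D u v → AtMostOne (CommonOut D) u v
  common-out-unique = at-most-one-on-every-arc CommonOut-preserved (x→ zero)
    λ w w′ → trans (only-out-of-a w) (sym (only-out-of-a w′))

  between : ∀ {u v} → E D u v → ∃ (Between D u v)
  between = witness-on-every-arc Between-preserved (x→ zero) (d , x→ (suc (suc (suc zero))) , C4-arc e30)

  between-unique : ∀ {u v} → E D u v → AtMostOne (Between D) u v
  between-unique = at-most-one-on-every-arc Between-preserved (x→ zero)
    λ w w′ → trans (only-into-a w) (sym (only-into-a w′))

  common-in : ∀ {u v} → E D u v → ∃ (CommonIn D u v)
  common-in = witness-on-every-arc CommonIn-preserved a→b (x , x→ zero , x→ (suc zero))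

  -- Otherwise, with two of
  -- them s ≠ s′, choosing for each in-neighbour t of v a common in-neighbour of
  -- t and v (taking s for t = u) is injective on the finite set N⁻(v), by
  -- uniqueness of the middle vertex of r → t → v, yet misses s′.
  common-in-unique : ∀ {u v} → E D u v → AtMostOne (CommonIn D) u v
  common-in-unique {u} {v} uv {s} {s′} (su , sv) (s′u , s′v) with s ≟ s′
  ... | yes s≡s′ = s≡s′
  ... | no  s≢s′ = ⊥-elim (injective-self-map-hits (N⁻ D v) (proj₁ (lf v))
                     (λ t tv → proj₂ (lf v) t (inj₂ tv)) ψ (λ t tv → proj₂ (ψ-common t tv))
                     ψ-injective s′ s′v (λ t tv → misses (t ≟ u) tv))
    where
    choice : ∀ {t} → Dec (t ≡ u) → E D t v → ∃ (CommonIn D t v)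
    choice (yes refl) _  = s , su , sv
    choice (no _)     tv = common-in tv

    ψ : ∀ t → E D t v → V D
    ψ t tv = proj₁ (choice (t ≟ u) tv)

    ψ-common : ∀ t tv → CommonIn D t v (ψ t tv)
    ψ-common t tv = proj₂ (choice (t ≟ u) tv)

    ψ-injective : ∀ t t′ tv t′v → ψ t tv ≡ ψ t′ t′v → t ≡ t′
    ψ-injective t t′ tv t′v same = between-unique (proj₂ (ψ-common t tv))
      (proj₁ (ψ-common t tv) , tv) (subst (λ r → E D r t′) (sym same) (proj₁ (ψ-common t′ t′v)) , t′v)

    misses : ∀ {t} (t≟u : Dec (t ≡ u)) tv → proj₁ (choice t≟u tv) ≢ s′
    misses (yes refl) _  = s≢s′
    misses (no t≢u)   tv r≡s′ = t≢u (between-unique s′v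
      (subst (λ r → E D r _) r≡s′ (proj₁ (proj₂ (common-in tv))) , tv) (s′u , uv))

  -- Every vertex w has out-degree four, and so has in-degree four: the
  -- in-neighbours of w are the common in-neighbours of w and its out-neighbours.
  out-enumeration : ∀ w → ∃ λ (h : Fin 4 → V D) → Enumerates (N⁺ D w) h
  out-enumeration w with g , gx≡w ← vertex-transitive x w =
    (λ i → apply g (f i)) , subst (λ z → Enumerates (N⁺ D z) _) gx≡w (enumeration-image g out-x)

  in-from-out : ∀ {w} {h : Fin 4 → V D} (out : Enumerates (N⁺ D w) h) →
                Enumerates (N⁻ D w) (λ i → proj₁ (common-in (proj₁ out i)))
  in-from-out {w} {h} (w→ , h-injective , h-onto) = into-w , injective , onto
    where
    into-w : ∀ i → E D (proj₁ (common-in (w→ i))) w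
    into-w i = proj₁ (proj₂ (common-in (w→ i)))

    injective : ∀ i j → proj₁ (common-in (w→ i)) ≡ proj₁ (common-in (w→ j)) → i ≡ j
    injective i j same = h-injective i j (common-out-unique (into-w i)
      (proj₂ (proj₂ (common-in (w→ i))) , w→ i)
      (subst (λ s → E D s (h j)) (sym same) (proj₂ (proj₂ (common-in (w→ j)))) , w→ j))

    onto : ∀ t → E D t w → ∃ λ i → proj₁ (common-in (w→ i)) ≡ t
    onto t tw with o , to , wo ← common-out tw with i , refl ← h-onto o wo =
      i , common-in-unique (w→ i) (proj₂ (common-in (w→ i))) (tw , to)

  -- N⁻(w) contains no directed triangle: inside N⁻(w) every vertex has exactly
  -- one out-neighbour and at most one in-neighbour, and N⁻(w) has four elements.
  no-in-triangle : ∀ {w p q r} → E D p q → E D q r → E D r p → E D p w → E D q w → E D r w → ⊥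
  no-in-triangle {w} pq qr rp pw qw rw with _ , out ← out-enumeration w =
    no-three-cycle (N⁻ D w) _ (in-from-out out) (E D)
      (λ t tw → let m , tm , mw = between tw in m , mw , tm)
      (λ tw t₁w t₂w tt₁ tt₂ → between-unique tw (tt₁ , t₁w) (tt₂ , t₂w))
      (λ t₁w t₂w tw t₁t t₂t → common-in-unique tw (t₁t , t₁w) (t₂t , t₂w))
      (irrefl D) pw qw rw pq qr rp

  common-out-moves : ∀ (g : Automorphism D) {u v u′ v′ y y′} →
    apply g u ≡ u′ → apply g v ≡ v′ → E D u′ v′ →
    CommonOut D u v y → CommonOut D u′ v′ y′ → apply g y ≡ y′
  common-out-moves g gu gv u′v′ (uy , vy) common′ =
    common-out-unique u′v′ (carries g gu refl uy , carries g gv refl vy) common′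

  x-a-y-induced : ∀ {y} → (∀ i → E D (f i) y) → InducedTwoArc D x a y
  x-a-y-induced {y} into = x→ zero , into zero , ¬x→y , ¬y→x
    where
    ¬x→y : ¬ E D x y
    ¬x→y xy with i , refl ← proj₂ (proj₂ out-x) y xy = irrefl D _ (into i)

    ¬y→x : ¬ E D y x
    ¬y→x yx with o , yo , xo ← common-out yx with i , refl ← proj₂ (proj₂ out-x) o xo =
      asym D _ _ (into i) yo

  -- No vertex y receives arcs from all of N⁺(x): an automorphism taking the
  -- induced 2-arc a → b → c onto x → a → y sends y to the common out-neighbour
  -- b of x and a, so the arc c → y becomes y → b, against b → y.
  not-all-into : ∀ {y} → (∀ i → E D (f i) y) → ⊥
  not-all-into {y} into = moved (two-arc-transitive a-b-c (x-a-y-induced into))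
    where
    moved : (Σ (Automorphism D) λ g → apply g a ≡ x × apply g b ≡ a × apply g c ≡ y) → ⊥
    moved (g , ga , gb , gc) = asym D _ _ (into (suc zero))
      (carries g gc gy (into (suc (suc zero))))
      where
      gy : apply g y ≡ b
      gy = common-out-moves g ga gb (x→ zero) (into zero , into (suc zero)) (x→ (suc zero) , a→b)

  -- If a, b and c all point to y, then so does d (move a → b → c onto d → a → b).
  d-into : ∀ {y} → E D a y → E D b y → E D c y → E D d y
  d-into ay by cy with g , ga , gb , gc ← two-arc-transitive a-b-c d-a-b =
    carries g ga (common-out-moves g gb gc a→b (by , cy) (ay , by)) ay

  impossible : ⊥
  impossible =
    let y , ay , by = common-out a→b
        e , be , ey = between by
    in ¬¬-excluded-middle λ a→e? → ¬¬-excluded-middle λ e→a? → cases ay by be ey a→e? e→a?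
    where
    cases : ∀ {y e} → E D a y → E D b y → E D b e → E D e y → Dec (E D a e) → Dec (E D e a) → ⊥
    -- a and b would be two common in-neighbours of e → y
    cases ay by be ey (yes ae) _ = arc-distinct D a→b (common-in-unique ey (ae , ay) (be , by))
    -- a → b → e → a would be a triangle in N⁻(y)
    cases ay by be ey (no _) (yes ea) = no-in-triangle a→b be ea ay by ey
    -- a → b → e is an induced 2-arc like a → b → c, so c → y as well
    cases ay by be ey (no ¬ae) (no ¬ea)
      with g , ga , gb , ge ← two-arc-transitive (a→b , be , ¬ae , ¬ea) a-b-c =
      c-into (carries g ge (common-out-moves g ga gb a→b (ay , by) (ay , by)) ey)
      where
      c-into : E D c _ → ⊥
      c-into cy = not-all-into λ { zero → ay ; (suc zero) → by ; (suc (suc zero)) → cy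
                                 ; (suc (suc (suc zero))) → d-into ay by cy }

out-neighbourhood-not-C4 : (D : Digraph) → DecidableEquality (V D) → LocallyFinite D →
  CHomogeneous D → (x : V D) → ¬ InducedIsoTo D (N⁺ D x) C4
out-neighbourhood-not-C4 D _≟_ lf hom x (f , iso) = OutNeighbourhoodC4.impossible D _≟_ lf hom x f iso

reverse : Digraph → Digraph
reverse D = record { V = V D ; E = λ u v → E D v u ; irrefl = irrefl D ; asym = λ u v → asym D v u }

reverse-walk : ∀ {D P s t} → Walk (reverse D) P s t → Walk D P s t
reverse-walk (here p)       = here p
reverse-walk (step p adj w) = step p (swap adj) (reverse-walk w)

reverse-locally-finite : ∀ {D} → LocallyFinite D → LocallyFinite (reverse D)
reverse-locally-finite lf u = proj₁ (lf u) , λ v adj → proj₂ (lf u) v (swap adj)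

reverse-C-homogeneous : ∀ {D} → CHomogeneous D → CHomogeneous (reverse D)
reverse-C-homogeneous hom P Q φ P-finite P-connected Q-finite Q-connected (into , injective , onto , arcs)
  with g , agrees ← hom P Q φ P-finite (λ s t ps pt → reverse-walk (P-connected s t ps pt))
                         Q-finite (λ s t qs qt → reverse-walk (Q-connected s t qs qt))
                         (into , injective , onto , λ u v pu pv → arcs v u pv pu)
  = (proj₁ g , λ u v → proj₂ g v u) , agrees

-- The reflection i ↦ -i of Fin 4 is an isomorphism from C4 onto its reverse.
reflect : Fin 4 → Fin 4
reflect zero                   = zero
reflect (suc zero)             = suc (suc (suc zero))
reflect (suc (suc zero))       = suc (suc zero)
reflect (suc (suc (suc zero))) = suc zero

reflect-involutive : ∀ i → reflect (reflect i) ≡ i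
reflect-involutive zero                   = refl
reflect-involutive (suc zero)             = refl
reflect-involutive (suc (suc zero))       = refl
reflect-involutive (suc (suc (suc zero))) = refl

reflect-arc : ∀ {i j} → C4E i j → C4E (reflect j) (reflect i)
reflect-arc e01 = e30
reflect-arc e12 = e23
reflect-arc e23 = e12
reflect-arc e30 = e01

reverse-in-C4 : ∀ {D x} → InducedIsoTo D (N⁻ D x) C4 → InducedIsoTo (reverse D) (N⁺ (reverse D) x) C4
reverse-in-C4 (f , into , injective , onto , arcs) =
    (λ i → f (reflect i))
  , (λ i _ → into (reflect i) tt)
  , (λ i j _ _ same → trans (sym (reflect-involutive i))
                        (trans (cong reflect (injective _ _ tt tt same)) (reflect-involutive j)))
  , (λ y xy → let i , _ , fi≡y = onto y xy in reflect i , tt , trans (cong f (reflect-involutive i)) fi≡y)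
  , λ i j _ _ → mk⇔
      (λ ij → Equivalence.to (arcs (reflect j) (reflect i) tt tt) (reflect-arc ij))
      (λ ji → subst₂ C4E (reflect-involutive i) (reflect-involutive j)
                (reflect-arc (Equivalence.from (arcs (reflect j) (reflect i) tt tt) ji)))

lemma3p3 : (D : Digraph) → Connected D → LocallyFinite D → CHomogeneous D →
    (x : V D) → ¬ InducedIsoTo D (N⁺ D x) C4 × ¬ InducedIsoTo D (N⁻ D x) C4
lemma3p3 D conn lf hom x =
    out-neighbourhood-not-C4 D _≟_ lf hom x
  , λ in-C4 → out-neighbourhood-not-C4 (reverse D) _≟_ (reverse-locally-finite {D} lf)
                (reverse-C-homogeneous {D} hom) x (reverse-in-C4 {D} {x} in-C4)
  where open WalkCodes D lf conn x using (_≟_)
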